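{- Let $S\subseteq\{0,\dots,n\}$ be a Sidon set and let $R\subseteq\{0,1\}^n$ be the relation $R(x_1,\dots,x_n)\equiv\left(\sum_{i=1}^n x_i\in S\right)$. Then $R$ is preserved by the $3$-universal operation $u_3$.
   Context: A Sidon set is a set $S$ of integers in which all sums $i+j$ with $i,j\in S$, $i\le j$, are distinct. The $3$-universal operation $u_3$ is the Boolean partial operation of arity $7$ with arguments indexed by $v\in\{0,1\}^3\setminus\{000\}$; for $j\in[3]$ let $s_j[v]=v[j]$; its domain is the two constant tuples (mapped to the constant), $s_1,s_2,s_3$ (mapped to $0$) and their complements (mapped to $1$). It is applied to tuples coordinatewise (defined iff defined in every coordinate), and $R$ is preserved if every defined application of $u_3$ to seven tuples of $R$ lies in $R$. -}

module Defs where

open import Data.Nat using (ℕ; _+_; _≤_)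
open import Data.Bool using (Bool; true; false; not)
open import Data.Fin using (Fin)
open import Data.Vec using (Vec; lookup)
open import Data.Fin.Subset using (Subset; ∣_∣)
open import Data.Product using (_×_; _,_; Σ)
open import Relation.Binary.PropositionalEquality using (_≡_; _≢_)

IsSidon : (ℕ → Set) → Set
IsSidon S = ∀ a b c d → S a → S b → S c → S d → a ≤ b → c ≤ d →
  a + b ≡ c + d → (a ≡ c) × (b ≡ d)

SubsetUpTo : ℕ → (ℕ → Set) → Set
SubsetUpTo n S = ∀ a → S a → a ≤ n

-- The relation R(x₁,…,xₙ) ≡ (x₁ + ⋯ + xₙ ∈ S) on {0,1}ⁿ (Booleans, true = 1).
SumRel : (n : ℕ) → (ℕ → Set) → Vec Bool n → Set
SumRel n S x = S ∣ x ∣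

-- Argument positions of u₃ : v ∈ {0,1}³ ∖ {000}
Idx : Set
Idx = Σ (Vec Bool 3) (λ v → v ≢ (false Data.Vec.∷ false Data.Vec.∷ false Data.Vec.∷ Data.Vec.[]))

s : Fin 3 → Idx → Bool
s j (v , _) = lookup v j

-- Graph of the partial operation u₃ : U3 a b means a ∈ dom u₃ and u₃(a) = b.
data U3 (a : Idx → Bool) : Bool → Set where
  u3-const : (c : Bool) → (∀ v → a v ≡ c) → U3 a c
  u3-proj  : (j : Fin 3) → (∀ v → a v ≡ s j v) → U3 a false
  u3-coproj : (j : Fin 3) → (∀ v → a v ≡ not (s j v)) → U3 a true

PreservedByU3 : (n : ℕ) → (Vec Bool n → Set) → Set
PreservedByU3 n R = (t : Idx → Vec Bool n) → (∀ v → R (t v)) →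
  (y : Vec Bool n) → (∀ i → U3 (λ v → lookup (t v) i) (lookup y i)) → R y

-- On every coordinate, the seven argument entries and the output of u₃ are the values of one
-- affine function on {0,1}³ (a constant, s_j or its complement), the output being its value at 000.
-- Summing over coordinates, the weights W(v) = |t_v| and W(000) = |y| form an affine map
-- W : {0,1}³ → ℕ, so W(a) + W(b) = W(c) + W(d) whenever a + b = c + d in ℤ³. Sidon applied to W(110) + W(101) = W(100) + W(111) forces W(110) = W(100) or
-- W(110) = W(111); the parallelograms 110 + 000 = 100 + 010 and 110 + 001 = 111 + 000 then give
-- W(000) = W(010) or W(000) = W(001), both in S.
module Submission where

open import Defs
open import Data.Nat using (ℕ; _+_)
open import Data.Nat.Properties using (+-comm; +-cancelˡ-≡; +-cancelʳ-≡; ≤-total; +-commutativeSemigroup)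
open import Algebra.Properties.CommutativeSemigroup +-commutativeSemigroup using (interchange)
open import Data.Bool using (Bool; true; false; not)
open import Data.Fin using (Fin; zero; suc)
open import Data.Vec using (Vec; []; _∷_; lookup; tabulate; zipWith; replicate)
open import Data.Vec.Properties using (lookup-zipWith; lookup-replicate; tabulate∘lookup; tabulate-cong)
open import Data.Fin.Subset using (∣_∣)
open import Data.Product using (Σ; _×_; _,_; proj₁; proj₂)
open import Data.Sum using (_⊎_; inj₁; inj₂)
open import Function using (_∘_)
open import Relation.Binary.PropositionalEquality
  using (_≡_; _≢_; refl; sym; trans; cong; cong₂; subst; module ≡-Reasoning)
open ≡-Reasoning

private
  variable
    k n : ℕ

toℕ : Bool → ℕ
toℕ false = 0
toℕ true  = 1

infixl 6 _+ᵇ_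
_+ᵇ_ : Bool → Bool → ℕ
x +ᵇ y = toℕ x + toℕ y

+-cancel-≡ : ∀ {a b c d} → a + b ≡ c + d → a ≡ c → b ≡ d
+-cancel-≡ {a} {b} {c} {d} e refl = +-cancelˡ-≡ a b d e

Sidon⇒unordered : ∀ {S} → IsSidon S → ∀ {a b c d} → S a → S b → S c → S d →
  a + b ≡ c + d → a ≡ c ⊎ a ≡ d
Sidon⇒unordered sid {a} {b} {c} {d} sa sb sc sd e with ≤-total a b | ≤-total c d
... | inj₁ a≤b | inj₁ c≤d = inj₁ (proj₁ (sid a b c d sa sb sc sd a≤b c≤d e))
... | inj₁ a≤b | inj₂ d≤c = inj₂ (proj₁ (sid a b d c sa sb sd sc a≤b d≤c (trans e (+-comm c d))))
... | inj₂ b≤a | inj₁ c≤d = inj₂ (proj₂ (sid b a c d sb sa sc sd b≤a c≤d (trans (+-comm b a) e)))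
... | inj₂ b≤a | inj₂ d≤c =
  inj₁ (proj₂ (sid b a d c sb sa sd sc b≤a d≤c (trans (+-comm b a) (trans e (+-comm c d)))))

Parallelogram : (a b c d : Vec Bool k) → Set
Parallelogram a b c d = zipWith _+ᵇ_ a b ≡ zipWith _+ᵇ_ c d

Parallelogram-lookup : ∀ {a b c d : Vec Bool k} → Parallelogram a b c d →
  ∀ j → lookup a j +ᵇ lookup b j ≡ lookup c j +ᵇ lookup d j
Parallelogram-lookup {a = a} {b} {c} {d} e j = begin
  lookup a j +ᵇ lookup b j           ≡⟨ lookup-zipWith _+ᵇ_ j a b ⟨
  lookup (zipWith _+ᵇ_ a b) j        ≡⟨ cong (λ v → lookup v j) e ⟩
  lookup (zipWith _+ᵇ_ c d) j        ≡⟨ lookup-zipWith _+ᵇ_ j c d ⟩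
  lookup c j +ᵇ lookup d j           ∎

Affine : (Vec Bool k → ℕ) → Set
Affine {k} W = ∀ {a b c d : Vec Bool k} → Parallelogram a b c d → W a + W b ≡ W c + W d

not+ᵇ-id : ∀ x → not x +ᵇ x ≡ 1
not+ᵇ-id false = refl
not+ᵇ-id true  = refl

not-+ᵇ : ∀ x y z w → x +ᵇ y ≡ z +ᵇ w → not x +ᵇ not y ≡ not z +ᵇ not w
not-+ᵇ x y z w e = +-cancelʳ-≡ (x +ᵇ y) _ _ (begin
  (not x +ᵇ not y) + (x +ᵇ y)                 ≡⟨ interchange (toℕ (not x)) _ _ _ ⟩
  (not x +ᵇ x) + (not y +ᵇ y)                 ≡⟨ cong₂ _+_ (not+ᵇ-id x) (not+ᵇ-id y) ⟩
  2                                           ≡⟨ cong₂ _+_ (not+ᵇ-id z) (not+ᵇ-id w) ⟨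
  (not z +ᵇ z) + (not w +ᵇ w)                 ≡⟨ interchange (toℕ (not z)) _ _ _ ⟩
  (not z +ᵇ not w) + (z +ᵇ w)                 ≡⟨ cong ((not z +ᵇ not w) +_) e ⟨
  (not z +ᵇ not w) + (x +ᵇ y)                 ∎)

-- The Boolean functions on {0,1}ᵏ that occur as columns of the domain of u_k.
data Shape (k : ℕ) : Set where
  const  : Bool → Shape k
  proj   : Fin k → Shape k
  coproj : Fin k → Shape k

eval : Shape k → Vec Bool k → Bool
eval (const c)  _ = c
eval (proj j)   v = lookup v j
eval (coproj j) v = not (lookup v j)

eval-affine : (σ : Shape k) → ∀ {a b c d} → Parallelogram a b c d →
  eval σ a +ᵇ eval σ b ≡ eval σ c +ᵇ eval σ d
eval-affine (const x)  e = refl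
eval-affine (proj j)   e = Parallelogram-lookup e j
eval-affine (coproj j) {a} {b} {c} {d} e =
  not-+ᵇ (lookup a j) (lookup b j) (lookup c j) (lookup d j) (Parallelogram-lookup e j)

∣x∷xs∣ : ∀ x (xs : Vec Bool n) → ∣ x ∷ xs ∣ ≡ toℕ x + ∣ xs ∣
∣x∷xs∣ false xs = refl
∣x∷xs∣ true  xs = refl

∣tabulate∣-+ : {X : Set} (f g h l : X → Bool) → (∀ x → f x +ᵇ g x ≡ h x +ᵇ l x) →
  (cs : Fin n → X) →
  ∣ tabulate (f ∘ cs) ∣ + ∣ tabulate (g ∘ cs) ∣ ≡ ∣ tabulate (h ∘ cs) ∣ + ∣ tabulate (l ∘ cs) ∣
∣tabulate∣-+ {n = ℕ.zero} f g h l e cs = refl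
∣tabulate∣-+ {n = ℕ.suc n} {X} f g h l e cs = begin
  ∣ F ∣ + ∣ G ∣                                ≡⟨ cong₂ _+_ (∣x∷xs∣ (f c) F′) (∣x∷xs∣ (g c) G′) ⟩
  (toℕ (f c) + ∣ F′ ∣) + (toℕ (g c) + ∣ G′ ∣)  ≡⟨ interchange (toℕ (f c)) _ _ _ ⟩
  (f c +ᵇ g c) + (∣ F′ ∣ + ∣ G′ ∣)             ≡⟨ cong₂ _+_ (e c) (∣tabulate∣-+ f g h l e (cs ∘ suc)) ⟩
  (h c +ᵇ l c) + (∣ H′ ∣ + ∣ L′ ∣)             ≡⟨ interchange (toℕ (h c)) _ _ _ ⟩
  (toℕ (h c) + ∣ H′ ∣) + (toℕ (l c) + ∣ L′ ∣)  ≡⟨ cong₂ _+_ (∣x∷xs∣ (h c) H′) (∣x∷xs∣ (l c) L′) ⟨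
  ∣ H ∣ + ∣ L ∣                                ∎
  where
  c : X
  c = cs zero
  F G H L : Vec Bool (ℕ.suc n)
  F = tabulate (f ∘ cs); G = tabulate (g ∘ cs); H = tabulate (h ∘ cs); L = tabulate (l ∘ cs)
  F′ G′ H′ L′ : Vec Bool n
  F′ = tabulate (f ∘ cs ∘ suc); G′ = tabulate (g ∘ cs ∘ suc)
  H′ = tabulate (h ∘ cs ∘ suc); L′ = tabulate (l ∘ cs ∘ suc)

samples : (Fin n → Shape k) → Vec Bool k → Vec Bool n
samples σ u = tabulate (λ i → eval (σ i) u)

∣samples∣-affine : (σ : Fin n → Shape k) → Affine (∣_∣ ∘ samples σ)
∣samples∣-affine σ {a} {b} {c} {d} e =
  ∣tabulate∣-+ (λ τ → eval τ a) (λ τ → eval τ b) (λ τ → eval τ c) (λ τ → eval τ d)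
    (λ τ → eval-affine τ e) σ

origin : Vec Bool 3
origin = replicate 3 false

U3⇒shape : ∀ {a b} → U3 a b → Σ (Shape 3) λ σ → (∀ v → a v ≡ eval σ (proj₁ v)) × b ≡ eval σ origin
U3⇒shape (u3-const c h)  = const c , h , refl
U3⇒shape (u3-proj j h)   = proj j , h , sym (lookup-replicate j false)
U3⇒shape (u3-coproj j h) = coproj j , h , sym (cong not (lookup-replicate j false))

U3-columns : ∀ {t : Idx → Vec Bool n} {y : Vec Bool n} →
  (∀ i → U3 (λ v → lookup (t v) i) (lookup y i)) →
  Σ (Fin n → Shape 3) λ σ → (∀ v → t v ≡ samples σ (proj₁ v)) × y ≡ samples σ origin
U3-columns {n = n} {t = t} {y} u3 =
  σ , (λ v → columns (t v) (λ i → proj₁ (proj₂ (U3⇒shape (u3 i))) v))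
    , columns y (λ i → proj₂ (proj₂ (U3⇒shape (u3 i))))
  where
  σ : Fin n → Shape 3
  σ i = proj₁ (U3⇒shape (u3 i))
  columns : ∀ (xs : Vec Bool n) {f} → (∀ i → lookup xs i ≡ f i) → xs ≡ tabulate f
  columns xs h = trans (sym (tabulate∘lookup xs)) (tabulate-cong h)

sidon-cube : ∀ {S} → IsSidon S → (W : Vec Bool 3 → ℕ) → Affine W →
  (∀ v → v ≢ origin → S (W v)) → S (W origin)
sidon-cube {S} sid W affine S-W = conclude (Sidon⇒unordered sid
  (S-W (pt 1 1 0) (λ ())) (S-W (pt 1 0 1) (λ ())) (S-W (pt 1 0 0) (λ ())) (S-W (pt 1 1 1) (λ ()))
  (affine {pt 1 1 0} {pt 1 0 1} {pt 1 0 0} {pt 1 1 1} refl))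
  where
  pt : ℕ → ℕ → ℕ → Vec Bool 3
  pt x y z = bit x ∷ bit y ∷ bit z ∷ []
    where
    bit : ℕ → Bool
    bit ℕ.zero = false
    bit (ℕ.suc _) = true
  conclude : W (pt 1 1 0) ≡ W (pt 1 0 0) ⊎ W (pt 1 1 0) ≡ W (pt 1 1 1) → S (W origin)
  conclude (inj₁ e) = subst S (sym (+-cancel-≡ (affine {pt 1 1 0} {origin} {pt 1 0 0} {pt 0 1 0} refl) e))
    (S-W (pt 0 1 0) (λ ()))
  conclude (inj₂ e) = subst S (+-cancel-≡ (affine {pt 1 1 0} {pt 0 0 1} {pt 1 1 1} {origin} refl) e)
    (S-W (pt 0 0 1) (λ ()))

lemma6 : (n : ℕ) (S : ℕ → Set) → SubsetUpTo n S → IsSidon S →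
    PreservedByU3 n (SumRel n S)
lemma6 n S _ sid t t∈R y u3 with U3-columns {t = t} {y} u3
... | σ , t≡ , y≡ =
  subst S (sym (cong ∣_∣ y≡))
    (sidon-cube sid (∣_∣ ∘ samples σ) (∣samples∣-affine σ)
      (λ v v≢origin → subst S (cong ∣_∣ (t≡ (v , v≢origin))) (t∈R (v , v≢origin))))
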